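{- The quantity $|\nu(G; s)|$ is antimonotonic. That is, for every sequence $s$ over a finite alphabet $\Sigma$, every episode $G$, and every sub-episode $H$ of $G$, we have $|\nu(H; s)| \ge |\nu(G; s)|$.
   Context: An episode is a directed acyclic graph $G = (V, E, \mathrm{lab})$ with node labeling $\mathrm{lab}: V \to \Sigma$. A sub-episode of $G$ is a labeled subgraph of $G$. A sequence $u = u_1 \cdots u_m$ covers $G$ if there is an injective map $f: V \to \{1,\dots,m\}$ with $u_{f(v)} = \mathrm{lab}(v)$ for all $v$, and $f(v) < f(w)$ for every edge $(v,w)$. For a sequence $s = s_1 \cdots s_L$, a window is a contiguous subsequence $s[i,j] = s_i \cdots s_j$ with $1 \le i \le j \le L$, identified by its index interval. A window is a minimal window of $G$ in $s$ if it covers $G$ and no proper sub-window covers $G$. Two windows overlap if their index intervals intersect. $\nu(G;s)$ is obtained greedily: order the minimal windows of $G$ in $s$ by occurrence (starting index), select the first one, and discard all windows overlapping it. Repeat until no windows remain. $\nu(G;s)$ is the set of selected windows. -}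

module Defs where

open import Data.Nat using (ℕ; zero; suc; _≤_; _<_; _∸_; s≤s)
open import Data.Nat.Properties using (_≤?_; allUpTo?; ≤-trans)
import Data.Nat.Properties as ℕP
open import Data.Fin using (Fin) renaming (_<_ to _<ᶠ_)
open import Data.Fin.Properties using (any?; all?) renaming (_≟_ to _≟ᶠ_; _<?_ to _<ᶠ?_)
open import Data.Bool using (Bool; T)
open import Data.List using (List; []; _∷_; length; lookup; take; drop; filter; map; concatMap; upTo)
open import Data.Vec using (Vec; []; _∷_) renaming (lookup to vlookup)
open import Data.Product using (Σ; ∃; _×_; _,_; proj₁; proj₂)
open import Relation.Binary.PropositionalEquality using (_≡_)
open import Relation.Binary.Construct.Closure.Transitive using (TransClosure)
open import Relation.Nullary using (¬_; Dec; yes; no; ¬?)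
open import Relation.Nullary.Decidable using (map′; _×-dec_; _→-dec_; T?)
open import Function.Definitions using (Injective)

record Episode (a : ℕ) : Set where
  field
    n       : ℕ
    lab     : Fin n → Fin a
    edge    : Fin n → Fin n → Bool
    acyclic : ¬ (Σ (Fin n) λ v → TransClosure (λ x y → T (edge x y)) v v)

open Episode public

SubEpisode : ∀ {a} → Episode a → Episode a → Set
SubEpisode H G =
  Σ (Fin (n H) → Fin (n G)) λ φ →
    Injective _≡_ _≡_ φ
    × (∀ v → lab H v ≡ lab G (φ v))
    × (∀ v w → T (edge H v w) → T (edge G (φ v) (φ w)))

-- Covering.  The map f : V → positions of u is written as a vector
-- (f v = vlookup f v); positions are 0-based.

CoverMap : ∀ {a} (G : Episode a) (u : List (Fin a)) → Vec (Fin (length u)) (n G) → Set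
CoverMap G u f =
  (∀ v w → vlookup f v ≡ vlookup f w → v ≡ w)
  × (∀ v → lookup u (vlookup f v) ≡ lab G v)
  × (∀ v w → T (edge G v w) → vlookup f v <ᶠ vlookup f w)

Covers : ∀ {a} → Episode a → List (Fin a) → Set
Covers G u = ∃ λ f → CoverMap G u f

-- windows s[i,j] (0-based, inclusive): i ≤ j < length s
Window : Set
Window = ℕ × ℕ

slice : ∀ {a} → List (Fin a) → ℕ → ℕ → List (Fin a)
slice s i j = take (suc j ∸ i) (drop i s)

-- all windows of a sequence of length L, ordered by starting index
-- (ties, which never occur among minimal windows, broken by end index)
allWindows : ℕ → List Window
allWindows L = concatMap (λ i → map (i ,_) (filter (i ≤?_) (upTo L))) (upTo L)

MinimalWindow : ∀ {a} → Episode a → List (Fin a) → Window → Set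
MinimalWindow G s (i , j) =
  Covers G (slice s i j)
  × (∀ i' j' → i ≤ i' → i' ≤ j' → j' ≤ j → ¬ (i' ≡ i × j' ≡ j)
       → ¬ Covers G (slice s i' j'))

Overlap : Window → Window → Set
Overlap (i , j) (i' , j') = i ≤ j' × i' ≤ j

vecAny? : ∀ {m} k {P : Vec (Fin m) k → Set} → (∀ v → Dec (P v)) → Dec (∃ P)
vecAny? zero P? = map′ ([] ,_) (λ { ([] , p) → p }) (P? [])
vecAny? (suc k) {P} P? =
  map′ (λ { (x , xs , p) → x ∷ xs , p }) (λ { (x ∷ xs , p) → x , xs , p })
       (any? (λ x → vecAny? k (λ xs → P? (x ∷ xs))))

covers? : ∀ {a} (G : Episode a) (u : List (Fin a)) → Dec (Covers G u)
covers? G u = vecAny? (n G) λ f →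
  all? (λ v → all? (λ w → (vlookup f v ≟ᶠ vlookup f w) →-dec (v ≟ᶠ w)))
  ×-dec all? (λ v → lookup u (vlookup f v) ≟ᶠ lab G v)
  ×-dec all? (λ v → all? (λ w → T? (edge G v w) →-dec (vlookup f v <ᶠ? vlookup f w)))

minimal? : ∀ {a} (G : Episode a) (s : List (Fin a)) (w : Window) → Dec (MinimalWindow G s w)
minimal? G s (i , j) = covers? G (slice s i j) ×-dec
  map′ (λ h i' j' p q r → h {i'} (s≤s (≤-trans q r)) {j'} (s≤s r) p q r)
       (λ h {i'} _ {j'} _ → h i' j')
       (allUpTo? (λ i' → allUpTo? (λ j' →
          (i ≤? i') →-dec ((i' ≤? j') →-dec ((j' ≤? j) →-dec
            (¬? ((i' ℕP.≟ i) ×-dec (j' ℕP.≟ j)) →-dec ¬? (covers? G (slice s i' j'))))))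
          (suc j)) (suc j))

overlap? : (w w' : Window) → Dec (Overlap w w')
overlap? (i , j) (i' , j') = (i ≤? j') ×-dec (i' ≤? j)

-- ν(G; s): greedy selection.  The fuel argument (initially the number of
-- minimal windows) only ensures termination; it never runs out.

greedy : ℕ → List Window → List Window
greedy zero    _        = []
greedy (suc k) []       = []
greedy (suc k) (w ∷ ws) = w ∷ greedy k (filter (λ x → ¬? (overlap? w x)) ws)

minimalWindows : ∀ {a} → Episode a → List (Fin a) → List Window
minimalWindows G s = filter (minimal? G s) (allWindows (length s))

ν : ∀ {a} → Episode a → List (Fin a) → List Window
ν G s = greedy (length (minimalWindows G s)) (minimalWindows G s)

-- Every window covering G also covers the sub-episode H, so every minimal window of G
-- contains a minimal window of H. Minimal windows of a fixed episode, listed by start,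
-- also have nondecreasing ends. The greedy selection for H can therefore follow the one
-- for G step by step: when G selects w, the first remaining minimal window h of H ends no
-- later than w, so whatever survives w's deletion still contains a window that survives
-- h's deletion.
module Submission where

open import Defs
open import Data.Nat using (ℕ; zero; suc; _≤_; _<_; _∸_; z≤n; s≤s)
open import Data.Nat.Properties
open import Data.Fin using (Fin) renaming (_<_ to _<ᶠ_)
open import Data.List using (List; []; _∷_; length; lookup; filter; map; upTo)
open import Data.List.Properties using (length-filter)
open import Data.List.Membership.Propositional using (_∈_)
open import Data.List.Membership.Propositional.Properties
open import Data.List.Relation.Unary.Any using (here; there; satisfied)
open import Data.List.Relation.Unary.All as All using (All; []; _∷_)
import Data.List.Relation.Unary.All.Properties as AllP
open import Data.List.Relation.Unary.AllPairs as AllPairs using (AllPairs; []; _∷_)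
import Data.List.Relation.Unary.AllPairs.Properties as AllPairsP
open import Data.Product using (∃; _×_; _,_; proj₁; proj₂)
open import Data.Product.Relation.Binary.Lex.Strict using (×-Lex)
open import Data.Sum using (inj₁; inj₂)
open import Data.Empty using (⊥-elim)
open import Relation.Binary.PropositionalEquality using (_≡_; refl; sym; trans; cong; subst₂)
open import Relation.Nullary using (¬_; Dec; yes; no; ¬?)
open import Relation.Nullary.Decidable using (_×-dec_)
import Data.Vec as Vec
open import Data.Vec.Properties using (lookup∘tabulate)

covers-subEpisode : ∀ {a} {G H : Episode a} {u : List (Fin a)} →
  SubEpisode H G → Covers G u → Covers H u
covers-subEpisode {u = u} (φ , φ-inj , φ-lab , φ-edge) (f , f-inj , f-lab , f-edge) =
  Vec.tabulate (λ v → Vec.lookup f (φ v)) ,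
  (λ v w eq → φ-inj (f-inj (φ v) (φ w) (subst₂ _≡_ (f∘φ v) (f∘φ w) eq))) ,
  (λ v → trans (cong (lookup u) (f∘φ v)) (trans (f-lab (φ v)) (sym (φ-lab v)))) ,
  (λ v w e → subst₂ _<ᶠ_ (sym (f∘φ v)) (sym (f∘φ w)) (f-edge (φ v) (φ w) (φ-edge v w e)))
  where
  f∘φ : ∀ v → Vec.lookup (Vec.tabulate (λ v → Vec.lookup f (φ v))) v ≡ Vec.lookup f (φ v)
  f∘φ = lookup∘tabulate (λ v → Vec.lookup f (φ v))

Valid : Window → Set
Valid (i , j) = i ≤ j

_⊑_ : Window → Window → Set
(i' , j') ⊑ (i , j) = i ≤ i' × j' ≤ j

_≼_ : Window → Window → Set
(i , j) ≼ (i' , j') = i ≤ i' × j ≤ j'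

Sorted : List Window → Set
Sorted ws = AllPairs _≼_ ws × All Valid ws

Refines : List Window → List Window → Set
Refines ws hs = ∀ {w} → w ∈ ws → ∃ λ h → h ∈ hs × h ⊑ w

dropOverlapping : Window → List Window → List Window
dropOverlapping w = filter (λ x → ¬? (overlap? w x))

sorted-dropOverlapping : ∀ w {ws} → Sorted ws → Sorted (dropOverlapping w ws)
sorted-dropOverlapping w (≼s , valid) = AllPairsP.filter⁺ _ ≼s , AllP.filter⁺ _ valid

¬overlap⇒ends-before : ∀ {i j i' j'} → (i , j) ≼ (i' , j') → i' ≤ j' →
  ¬ Overlap (i , j) (i' , j') → j < i'
¬overlap⇒ends-before {j = j} {i'} (i≤i' , _) i'≤j' disjoint with i' ≤? j
... | yes i'≤j = ⊥-elim (disjoint (≤-trans i≤i' i'≤j' , i'≤j))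
... | no  i'≰j = ≰⇒> i'≰j

ends-before⇒¬overlap : ∀ {i j i' j'} → j < i' → ¬ Overlap (i , j) (i' , j')
ends-before⇒¬overlap j<i' (_ , i'≤j) = <⇒≱ j<i' i'≤j

head-ends-first : ∀ {h hs i' j'} → Sorted (h ∷ hs) → (i' , j') ∈ h ∷ hs → proj₂ h ≤ j'
head-ends-first _              (here refl) = ≤-refl
head-ends-first (h≼hs ∷ _ , _) (there m)   = proj₂ (All.lookup h≼hs m)

refines-dropOverlapping : ∀ {i j a b ws hs} →
  Sorted ((i , j) ∷ ws) → Sorted ((a , b) ∷ hs) → b ≤ j → Refines ws ((a , b) ∷ hs) →
  Refines (dropOverlapping (i , j) ws) (dropOverlapping (a , b) hs)
refines-dropOverlapping {i} {j} {a} {b} {ws} {hs}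
  (w≼ws ∷ _ , _ ∷ valid) (_ , a≤b ∷ _) b≤j refines {i' , j'} m
  with m∈ws , disjoint ← ∈-filter⁻ (λ x → ¬? (overlap? (i , j) x)) {xs = ws} m
  with (c , d) , h∈ , (i'≤c , d≤j') ← refines m∈ws
  = (c , d) , survives h∈ , (i'≤c , d≤j')
  where
  b<c : b < c
  b<c = ≤-trans (s≤s b≤j)
          (≤-trans (¬overlap⇒ends-before (All.lookup w≼ws m∈ws) (All.lookup valid m∈ws) disjoint)
                   i'≤c)
  survives : (c , d) ∈ (a , b) ∷ hs → (c , d) ∈ dropOverlapping (a , b) hs
  survives (here refl) = ⊥-elim (<⇒≱ b<c a≤b)
  survives (there m')  = ∈-filter⁺ _ m' (ends-before⇒¬overlap b<c)

greedy-length-mono : ∀ k₁ k₂ {ws hs} → length ws ≤ k₁ → length hs ≤ k₂ →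
  Sorted ws → Sorted hs → Refines ws hs → length (greedy k₁ ws) ≤ length (greedy k₂ hs)
greedy-length-mono zero     _        _  _  _ _ _ = z≤n
greedy-length-mono (suc k₁) _ {[]}   _  _  _ _ _ = z≤n
greedy-length-mono (suc k₁) _ {_ ∷ _} {[]} _ _ _ _ refines with refines (here refl)
... | _ , () , _
greedy-length-mono (suc k₁) zero {_ ∷ _} {_ ∷ _} _ () _ _ _
greedy-length-mono (suc k₁) (suc k₂) {(i , j) ∷ ws} {(a , b) ∷ hs}
  (s≤s ≤k₁) (s≤s ≤k₂) sw@(_ ∷ ≼ws , _ ∷ valid-ws) sh@(_ ∷ ≼hs , _ ∷ valid-hs) refines =
  s≤s (greedy-length-mono k₁ k₂
        (≤-trans (length-filter _ ws) ≤k₁) (≤-trans (length-filter _ hs) ≤k₂)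
        (sorted-dropOverlapping (i , j) (≼ws , valid-ws))
        (sorted-dropOverlapping (a , b) (≼hs , valid-hs))
        (refines-dropOverlapping sw sh b≤j (λ m → refines (there m))))
  where
  b≤j : b ≤ j
  b≤j with _ , h∈ , (_ , d≤j) ← refines (here refl) = ≤-trans (head-ends-first sh h∈) d≤j

allPairs-mapWithin : ∀ {A : Set} {P : A → Set} {R S : A → A → Set} →
  (∀ {x y} → P x → P y → R x y → S x y) → ∀ {xs} → All P xs → AllPairs R xs → AllPairs S xs
allPairs-mapWithin R⇒S []         []          = []
allPairs-mapWithin R⇒S (px ∷ pxs) (Rx ∷ Rxs) =
  All.zipWith (λ (py , Rxy) → R⇒S px py Rxy) (pxs , Rx) ∷ allPairs-mapWithin R⇒S pxs Rxs

_<ˡᵉˣ_ : Window → Window → Set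
_<ˡᵉˣ_ = ×-Lex _≡_ _<_ _<_

windowsFrom : ℕ → ℕ → List Window
windowsFrom L i = map (i ,_) (filter (i ≤?_) (upTo L))

allWindows-lex : ∀ L → AllPairs _<ˡᵉˣ_ (allWindows L)
allWindows-lex L = AllPairsP.concat⁺
  (AllP.map⁺ (All.universal (λ i → AllPairsP.map⁺ (AllPairs.map (λ j<j' → inj₂ (refl , j<j'))
                                     (AllPairsP.filter⁺ (i ≤?_) upTo-increasing))) (upTo L)))
  (AllPairsP.map⁺ (AllPairsP.applyUpTo⁺₁ (λ i → i) L (λ i<i' _ → rows-ordered i<i')))
  where
  upTo-increasing : AllPairs _<_ (upTo L)
  upTo-increasing = AllPairsP.applyUpTo⁺₁ (λ i → i) L (λ i<j _ → i<j)
  starts : ∀ i (js : List ℕ) → All (λ w → proj₁ w ≡ i) (map (i ,_) js)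
  starts i []       = []
  starts i (_ ∷ js) = refl ∷ starts i js
  rows-ordered : ∀ {i i'} → i < i' → All (λ w → All (w <ˡᵉˣ_) (windowsFrom L i')) (windowsFrom L i)
  rows-ordered i<i' =
    All.map (λ { refl → All.map (λ { refl → inj₁ i<i' }) (starts _ _) }) (starts _ _)

∈-allWindows⁻ : ∀ L {i j} → (i , j) ∈ allWindows L → i ≤ j × j < L
∈-allWindows⁻ L m
  with i , m′ ← satisfied (∈-concatMap⁻ (windowsFrom L) {xs = upTo L} m)
  with j , m″ , refl ← ∈-map⁻ (i ,_) m′
  with j∈ , i≤j ← ∈-filter⁻ (i ≤?_) {xs = upTo L} m″
  = i≤j , ∈-upTo⁻ j∈

∈-allWindows⁺ : ∀ L {i j} → i ≤ j → j < L → (i , j) ∈ allWindows L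
∈-allWindows⁺ L {i} i≤j j<L = ∈-concat⁺′
  (∈-map⁺ (i ,_) (∈-filter⁺ (i ≤?_) (∈-upTo⁺ j<L) i≤j))
  (∈-map⁺ (windowsFrom L) (∈-upTo⁺ (≤-<-trans i≤j j<L)))

proper-subwindow-shorter : ∀ {i i' j' j} → i ≤ i' → i' ≤ j' → j' ≤ j →
  ¬ (i' ≡ i × j' ≡ j) → j' ∸ i' < j ∸ i
proper-subwindow-shorter {i} {i'} {j'} {j} i≤i' i'≤j' j'≤j proper with i ≟ i' | j' ≟ j
... | yes refl | yes refl = ⊥-elim (proper (refl , refl))
... | no  i≢i' | _        =
  ≤-<-trans (∸-monoˡ-≤ i' j'≤j) (∸-monoʳ-< (≤∧≢⇒< i≤i' i≢i') (≤-trans i'≤j' j'≤j))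
... | yes refl | no j'≢j  = ∸-monoˡ-< (≤∧≢⇒< j'≤j j'≢j) i'≤j'

module _ {a} (E : Episode a) (s : List (Fin a)) where

  ∈-minimalWindows⁻ : ∀ {w} → w ∈ minimalWindows E s →
    MinimalWindow E s w × Valid w × proj₂ w < length s
  ∈-minimalWindows⁻ m with m′ , minimal ← ∈-filter⁻ (minimal? E s) {xs = allWindows (length s)} m
    = minimal , ∈-allWindows⁻ (length s) m′

  ∈-minimalWindows⁺ : ∀ {i j} → i ≤ j → j < length s → MinimalWindow E s (i , j) →
    (i , j) ∈ minimalWindows E s
  ∈-minimalWindows⁺ i≤j j<L = ∈-filter⁺ (minimal? E s) (∈-allWindows⁺ (length s) i≤j j<L)

  -- A later start with an earlier end would be a proper sub-window of a minimal window.
  minimal-<ˡᵉˣ⇒≼ : ∀ {i j i' j'} → MinimalWindow E s (i , j) → MinimalWindow E s (i' , j') →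
    i' ≤ j' → (i , j) <ˡᵉˣ (i' , j') → (i , j) ≼ (i' , j')
  minimal-<ˡᵉˣ⇒≼ {j = j} {i'} {j'} (_ , no-proper) (covers' , _) i'≤j' (inj₁ i<i') with j ≤? j'
  ... | yes j≤j' = <⇒≤ i<i' , j≤j'
  ... | no  j≰j' = ⊥-elim (no-proper i' j' (<⇒≤ i<i') i'≤j' (<⇒≤ (≰⇒> j≰j'))
                                     (λ (i'≡i , _) → <⇒≢ i<i' (sym i'≡i)) covers')
  minimal-<ˡᵉˣ⇒≼ _ _ _ (inj₂ (refl , j<j')) = ≤-refl , <⇒≤ j<j'

  minimalWindows-sorted : Sorted (minimalWindows E s)
  minimalWindows-sorted =
    allPairs-mapWithin (λ (mw , _) (mw' , vw' , _) → minimal-<ˡᵉˣ⇒≼ mw mw' vw')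
      (All.tabulate ∈-minimalWindows⁻)
      (AllPairsP.filter⁺ (minimal? E s) (allWindows-lex (length s)))
    , All.tabulate (λ m → proj₁ (proj₂ (∈-minimalWindows⁻ m)))

  CoveringSubWindow : ℕ → ℕ → ℕ → ℕ → Set
  CoveringSubWindow i j i' j' =
    i ≤ i' × i' ≤ j' × j' ≤ j × ¬ (i' ≡ i × j' ≡ j) × Covers E (slice s i' j')

  coveringSubWindow? : ∀ i j i' j' → Dec (CoveringSubWindow i j i' j')
  coveringSubWindow? i j i' j' = (i ≤? i') ×-dec (i' ≤? j') ×-dec (j' ≤? j) ×-dec
    ¬? ((i' ≟ i) ×-dec (j' ≟ j)) ×-dec covers? E (slice s i' j')

  covering⇒contains-minimal : ∀ k {i j} → j ∸ i < k → i ≤ j → Covers E (slice s i j) →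
    ∃ λ i' → ∃ λ j' → i' ≤ j' × (i' , j') ⊑ (i , j) × MinimalWindow E s (i' , j')
  covering⇒contains-minimal (suc k) {i} {j} j∸i<k i≤j covers
    with anyUpTo? (λ i' → anyUpTo? (coveringSubWindow? i j i') (suc j)) (suc j)
  ... | yes (i' , _ , j' , _ , i≤i' , i'≤j' , j'≤j , proper , covers')
    with i″ , j″ , i″≤j″ , (i'≤i″ , j″≤j') , minimal ← covering⇒contains-minimal k
           (≤-trans (proper-subwindow-shorter i≤i' i'≤j' j'≤j proper) (≤-pred j∸i<k)) i'≤j' covers'
    = i″ , j″ , i″≤j″ , (≤-trans i≤i' i'≤i″ , ≤-trans j″≤j' j'≤j) , minimal
  ... | no none = i , j , i≤j , (≤-refl , ≤-refl) , covers ,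
    λ i' j' i≤i' i'≤j' j'≤j proper covers' →
      none (i' , s≤s (≤-trans i'≤j' j'≤j) , j' , s≤s j'≤j , i≤i' , i'≤j' , j'≤j , proper , covers')

minimalWindows-refines : ∀ {a} (s : List (Fin a)) {G H : Episode a} → SubEpisode H G →
  Refines (minimalWindows G s) (minimalWindows H s)
minimalWindows-refines s {G} {H} H⊆G {i , j} m
  with (coversG , _) , i≤j , j<L ← ∈-minimalWindows⁻ G s m
  with i' , j' , i'≤j' , (i≤i' , j'≤j) , minimal ←
         covering⇒contains-minimal H s (suc (j ∸ i)) {i} {j} ≤-refl i≤j
           (covers-subEpisode {G = G} {H} {slice s i j} H⊆G coversG)
  = (i' , j') , ∈-minimalWindows⁺ H s i'≤j' (≤-<-trans j'≤j j<L) minimal , (i≤i' , j'≤j)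

mainTheorem9 : ∀ {a : ℕ} (s : List (Fin a)) (G H : Episode a) →
    SubEpisode H G → length (ν G s) ≤ length (ν H s)
mainTheorem9 s G H H⊆G =
  greedy-length-mono _ _ ≤-refl ≤-refl
    (minimalWindows-sorted G s) (minimalWindows-sorted H s) (minimalWindows-refines s {G} {H} H⊆G)
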